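{- Let $n\ge 1$ and let $[S,T]$ be a Tamari interval of size $n$. The following are equivalent: (a) for every $i\in[n-1]$, $r_S(i)\ne0$ or $l_T(i+1)\ne0$ (i.e. the Tamari interval diagram $(u,v)$ with $u_i=r_S(i)$, $v_j=l_T(j)$ is synchronized); (b) $S$ and $T$ have the same canopy (i.e. $[S,T]$ is a synchronized Tamari interval).
   Context: Binary trees with $n$ nodes have their nodes labeled $1,\dots,n$ in in-order; $r_B(i)$ (resp. $l_B(i)$) is the number of nodes in the right (resp. left) subtree of node $i$ in $B$. The Tamari order $\leq_{\mathrm{t}}$ is the reflexive–transitive closure of right rotation $((A,x,B),y,C)\mapsto(A,x,(B,y,C))$; a Tamari interval is a pair $[S,T]$ with $S\leq_{\mathrm{t}}T$. The canopy of a binary tree with $n$ nodes (and $n+1$ leaves) is the word of length $n-1$ recording, for each leaf other than the first and the last in left-to-right order, whether it is a left child or a right child. (The pair $(u,v)$ with $u_i=r_S(i)$, $v_j=l_T(j)$ is the Tamari interval diagram associated with $[S,T]$ through the Châtel–Pons bijection between Tamari intervals and interval-posets; a Tamari interval diagram $(u,v)$ of size $n$ is called synchronized if for all $i\in[n-1]$, $u_i\ne0$ or $v_{i+1}\ne0$.) -}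

module Defs where

open import Data.Nat using (ℕ; zero; suc; _+_)
open import Data.List using (List; []; _∷_; _++_; [_])
open import Relation.Binary.Construct.Closure.ReflexiveTransitive using (Star)

-- Binary trees (leaves are empty subtrees; nodes are the labelled vertices)
data BT : Set where
  leaf : BT
  node : BT → BT → BT

size : BT → ℕ
size leaf = 0
size (node a b) = size a + 1 + size b

data _⟶r_ : BT → BT → Set where
  rot   : ∀ a b c → node (node a b) c ⟶r node a (node b c)
  left  : ∀ {a a'} b → a ⟶r a' → node a b ⟶r node a' b
  right : ∀ a {b b'} → b ⟶r b' → node a b ⟶r node a b'

_≤t_ : BT → BT → Set
_≤t_ = Star _⟶r_

-- In-order list of right-subtree sizes: entry k (0-based) is r_B(k+1)
rsizes : BT → List ℕ
rsizes leaf = []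
rsizes (node a b) = rsizes a ++ (size b ∷ rsizes b)

-- In-order list of left-subtree sizes: entry k (0-based) is l_B(k+1)
lsizes : BT → List ℕ
lsizes leaf = []
lsizes (node a b) = lsizes a ++ (size a ∷ lsizes b)

-- 0-based lookup with default 0 (only used at in-range indices)
at : List ℕ → ℕ → ℕ
at [] _ = 0
at (x ∷ xs) zero = x
at (x ∷ xs) (suc k) = at xs k

-- r_B(i), l_B(i) for in-order labels i ∈ [1, n]
r : BT → ℕ → ℕ
r B i = at (rsizes B) (i Data.Nat.∸ 1)

l : BT → ℕ → ℕ
l B i = at (lsizes B) (i Data.Nat.∸ 1)

-- direction of a leaf relative to its parent
data Dir : Set where
  L R : Dir

leafDirs : BT → Dir → List Dir
leafDirs leaf d = [ d ]
leafDirs (node a b) _ = leafDirs a L ++ leafDirs b R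

dropLast : {A : Set} → List A → List A
dropLast [] = []
dropLast (x ∷ []) = []
dropLast (x ∷ y ∷ xs) = x ∷ dropLast (y ∷ xs)

tail : {A : Set} → List A → List A
tail [] = []
tail (_ ∷ xs) = xs

-- canopy: directions of all leaves except the first and the last
-- (for a tree with n ≥ 1 nodes every leaf has a parent; the initial
--  direction argument is irrelevant then)
canopy : BT → List Dir
canopy B = dropLast (tail (leafDirs B L))

module Submission where

-- The leaf
-- immediately after node i is a right child iff r(i) = 0, and the leaf
-- immediately before node i is a left child iff l(i) = 0.  Hence the canopy of
-- S is determined by the right-subtree sizes of S, and the canopy of T by the
-- left-subtree sizes of T:  canopy S = map dirAfter  (dropLast (rsizes S))  and
-- canopy T = map dirBefore (tail (lsizes T)).
-- A right rotation can only turn a right leaf into a left leaf, so along the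
-- Tamari order the canopy grows pointwise for the order R ⊑ L.  Comparing the
-- two canopies position by position, the only possible disagreement (R in S,
-- L in T) is exactly a position i with r_S(i) = 0 and l_T(i+1) = 0.  So the
-- canopies agree iff every position is "synchronized", which after translating
-- list positions into in-order labels is condition (a).

open import Defs
open import Data.Nat using (ℕ; _≤_; _+_)
open import Data.Sum using (_⊎_)
open import Data.List using (List)
open import Relation.Binary.PropositionalEquality using (_≡_; _≢_)
open import Function.Bundles using (_⇔_)

open import Level using (0ℓ)
open import Data.Nat using (zero; suc; pred; _<_; s≤s; z≤n)
open import Data.Nat.Properties using (+-comm; +-assoc; +-suc; suc-injective)
open import Data.Sum using (inj₁; inj₂)
open import Data.Empty using (⊥-elim)
open import Data.List using ([]; _∷_; _++_; [_]; map; length)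
open import Data.List.Properties using (++-assoc; map-++; length-++; ∷-injectiveˡ; ∷-injectiveʳ)
open import Data.List.Relation.Binary.Pointwise as Pw using (Pointwise; []; _∷_)
open import Relation.Binary.PropositionalEquality
  using (refl; sym; trans; cong; cong₂; subst; subst₂; module ≡-Reasoning)
open import Relation.Binary.Construct.Closure.ReflexiveTransitive using (ε; _◅_)
open import Function.Bundles using (mk⇔; Equivalence)
open import Function.Properties.Equivalence using (⇔-setoid) renaming (refl to ⇔-refl)
import Relation.Binary.Reasoning.Setoid as SetoidReasoning

module _ {A : Set} where

  dropLast-snoc : (xs : List A) (x : A) → dropLast (xs ++ [ x ]) ≡ xs
  dropLast-snoc []           x = refl
  dropLast-snoc (y ∷ [])     x = refl
  dropLast-snoc (y ∷ z ∷ xs) x = cong (y ∷_) (dropLast-snoc (z ∷ xs) x)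

  dropLast-tail-snoc : (xs : List A) (x : A) → dropLast (tail (xs ++ [ x ])) ≡ tail xs
  dropLast-tail-snoc []       x = refl
  dropLast-tail-snoc (y ∷ xs) x = dropLast-snoc xs x

  map-tail : {B : Set} (f : A → B) (xs : List A) → tail (map f xs) ≡ map f (tail xs)
  map-tail f []       = refl
  map-tail f (x ∷ xs) = refl

  map-dropLast : {B : Set} (f : A → B) (xs : List A) → dropLast (map f xs) ≡ map f (dropLast xs)
  map-dropLast f []           = refl
  map-dropLast f (x ∷ [])     = refl
  map-dropLast f (x ∷ y ∷ xs) = cong (f x ∷_) (map-dropLast f (y ∷ xs))

  length-dropLast : (xs : List A) → length (dropLast xs) ≡ pred (length xs)
  length-dropLast []           = refl
  length-dropLast (x ∷ [])     = refl
  length-dropLast (x ∷ y ∷ xs) = cong suc (length-dropLast (y ∷ xs))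

  length-tail : (xs : List A) → length (tail xs) ≡ pred (length xs)
  length-tail []       = refl
  length-tail (x ∷ xs) = refl

  pointwise-tail : {R : A → A → Set} {xs ys : List A} →
                   Pointwise R xs ys → Pointwise R (tail xs) (tail ys)
  pointwise-tail []       = []
  pointwise-tail (p ∷ ps) = ps

  pointwise-dropLast : {R : A → A → Set} {xs ys : List A} →
                       Pointwise R xs ys → Pointwise R (dropLast xs) (dropLast ys)
  pointwise-dropLast []            = []
  pointwise-dropLast (p ∷ [])     = []
  pointwise-dropLast (p ∷ q ∷ ps) = p ∷ pointwise-dropLast (q ∷ ps)

at-tail : (xs : List ℕ) (k : ℕ) → at (tail xs) k ≡ at xs (suc k)
at-tail []       k = refl
at-tail (x ∷ xs) k = refl

at-dropLast : (xs : List ℕ) (k : ℕ) → k < length (dropLast xs) → at (dropLast xs) k ≡ at xs k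
at-dropLast (x ∷ y ∷ xs) zero    _         = refl
at-dropLast (x ∷ y ∷ xs) (suc k) (s≤s lt) = at-dropLast (y ∷ xs) k lt

pointwise-at : {P : ℕ → ℕ → Set} {xs ys : List ℕ} →
               Pointwise P xs ys → (k : ℕ) → k < length xs → P (at xs k) (at ys k)
pointwise-at (p ∷ ps) zero    _        = p
pointwise-at (p ∷ ps) (suc k) (s≤s lt) = pointwise-at ps k lt

at-pointwise : {P : ℕ → ℕ → Set} (xs ys : List ℕ) → length xs ≡ length ys →
               ((k : ℕ) → k < length xs → P (at xs k) (at ys k)) → Pointwise P xs ys
at-pointwise []       []       _  _ = []
at-pointwise (x ∷ xs) (y ∷ ys) eq h =
  h zero (s≤s z≤n) ∷ at-pointwise xs ys (suc-injective eq) (λ k lt → h (suc k) (s≤s lt))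

pointwise-shifted : {P : ℕ → ℕ → Set} (xs ys : List ℕ) (m : ℕ) →
                    length xs ≡ suc m → length ys ≡ suc m →
                    Pointwise P (dropLast xs) (tail ys) ⇔ ((k : ℕ) → k < m → P (at xs k) (at ys (k + 1)))
pointwise-shifted {P} xs ys m lenXs lenYs = mk⇔ to from
  where
  lenD : length (dropLast xs) ≡ m
  lenD = trans (length-dropLast xs) (cong pred lenXs)

  lenT : length (tail ys) ≡ m
  lenT = trans (length-tail ys) (cong pred lenYs)

  at-tail′ : (k : ℕ) → at (tail ys) k ≡ at ys (k + 1)
  at-tail′ k = trans (at-tail ys k) (cong (at ys) (+-comm 1 k))

  to : Pointwise P (dropLast xs) (tail ys) → (k : ℕ) → k < m → P (at xs k) (at ys (k + 1))
  to pw k k<m = subst₂ P (at-dropLast xs k k<len) (at-tail′ k) (pointwise-at pw k k<len)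
    where
    k<len : k < length (dropLast xs)
    k<len = subst (k <_) (sym lenD) k<m

  from : ((k : ℕ) → k < m → P (at xs k) (at ys (k + 1))) → Pointwise P (dropLast xs) (tail ys)
  from h = at-pointwise (dropLast xs) (tail ys) (trans lenD (sym lenT)) λ k k<len →
    subst₂ P (sym (at-dropLast xs k k<len)) (sym (at-tail′ k)) (h k (subst (k <_) lenD k<len))

-- The leaf just after a
-- node with right subtree of size x is a right child iff x = 0; the leaf just
-- before a node with left subtree of size y is a left child iff y = 0.

dirAfter : ℕ → Dir
dirAfter zero    = R
dirAfter (suc _) = L

dirBefore : ℕ → Dir
dirBefore zero    = L
dirBefore (suc _) = R

firstLeafDir : BT → Dir → Dir
firstLeafDir leaf       d = d
firstLeafDir (node _ _) _ = L

lastLeafDir : BT → Dir → Dir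
lastLeafDir leaf       d = d
lastLeafDir (node _ _) _ = R

size-node : (a c : BT) → size (node a c) ≡ suc (size a + size c)
size-node a c = trans (+-assoc (size a) 1 (size c)) (+-suc (size a) (size c))

firstLeafDir-L : (b : BT) → firstLeafDir b L ≡ L
firstLeafDir-L leaf       = refl
firstLeafDir-L (node _ _) = refl

lastLeafDir-R : (b : BT) → lastLeafDir b R ≡ R
lastLeafDir-R leaf       = refl
lastLeafDir-R (node _ _) = refl

firstLeafDir-R : (b : BT) → firstLeafDir b R ≡ dirAfter (size b)
firstLeafDir-R leaf       = refl
firstLeafDir-R (node a c) rewrite size-node a c = refl

lastLeafDir-L : (b : BT) → lastLeafDir b L ≡ dirBefore (size b)
lastLeafDir-L leaf       = refl
lastLeafDir-L (node a c) rewrite size-node a c = refl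

-- Every leaf but the first follows a node, and its direction is given by
-- that node's right subtree size.
leafDirs-rsizes : (b : BT) (d : Dir) → leafDirs b d ≡ firstLeafDir b d ∷ map dirAfter (rsizes b)
leafDirs-rsizes leaf       d = refl
leafDirs-rsizes (node a c) d = begin
  leafDirs a L ++ leafDirs c R
    ≡⟨ cong₂ _++_ (leafDirs-rsizes a L) (leafDirs-rsizes c R) ⟩
  (firstLeafDir a L ∷ map dirAfter (rsizes a)) ++ (firstLeafDir c R ∷ map dirAfter (rsizes c))
    ≡⟨ cong₂ (λ x y → (x ∷ map dirAfter (rsizes a)) ++ (y ∷ map dirAfter (rsizes c)))
             (firstLeafDir-L a) (firstLeafDir-R c) ⟩
  L ∷ map dirAfter (rsizes a) ++ map dirAfter (size c ∷ rsizes c)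
    ≡⟨ cong (L ∷_) (map-++ dirAfter (rsizes a) (size c ∷ rsizes c)) ⟨
  L ∷ map dirAfter (rsizes a ++ size c ∷ rsizes c)
    ∎
  where open ≡-Reasoning

-- Every leaf but the last precedes a node, and its direction is given by
-- that node's left subtree size.
leafDirs-lsizes : (b : BT) (d : Dir) → leafDirs b d ≡ map dirBefore (lsizes b) ++ [ lastLeafDir b d ]
leafDirs-lsizes leaf       d = refl
leafDirs-lsizes (node a c) d = begin
  leafDirs a L ++ leafDirs c R
    ≡⟨ cong₂ _++_ (leafDirs-lsizes a L) (leafDirs-lsizes c R) ⟩
  (as ++ [ lastLeafDir a L ]) ++ (cs ++ [ lastLeafDir c R ])
    ≡⟨ cong₂ (λ x y → (as ++ [ x ]) ++ (cs ++ [ y ])) (lastLeafDir-L a) (lastLeafDir-R c) ⟩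
  (as ++ [ dirBefore (size a) ]) ++ (cs ++ [ R ])
    ≡⟨ ++-assoc as [ dirBefore (size a) ] (cs ++ [ R ]) ⟩
  as ++ (dirBefore (size a) ∷ cs ++ [ R ])
    ≡⟨ ++-assoc as (dirBefore (size a) ∷ cs) [ R ] ⟨
  (as ++ map dirBefore (size a ∷ lsizes c)) ++ [ R ]
    ≡⟨ cong (_++ [ R ]) (map-++ dirBefore (lsizes a) (size a ∷ lsizes c)) ⟨
  map dirBefore (lsizes a ++ size a ∷ lsizes c) ++ [ R ]
    ∎
  where
  open ≡-Reasoning
  as cs : List Dir
  as = map dirBefore (lsizes a)
  cs = map dirBefore (lsizes c)

canopy-rsizes : (b : BT) → canopy b ≡ map dirAfter (dropLast (rsizes b))
canopy-rsizes b = begin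
  dropLast (tail (leafDirs b L))          ≡⟨ cong (λ ds → dropLast (tail ds)) (leafDirs-rsizes b L) ⟩
  dropLast (map dirAfter (rsizes b))      ≡⟨ map-dropLast dirAfter (rsizes b) ⟩
  map dirAfter (dropLast (rsizes b))      ∎
  where open ≡-Reasoning

canopy-lsizes : (b : BT) → canopy b ≡ map dirBefore (tail (lsizes b))
canopy-lsizes b = begin
  dropLast (tail (leafDirs b L))
    ≡⟨ cong (λ ds → dropLast (tail ds)) (leafDirs-lsizes b L) ⟩
  dropLast (tail (map dirBefore (lsizes b) ++ [ lastLeafDir b L ]))
    ≡⟨ dropLast-tail-snoc (map dirBefore (lsizes b)) (lastLeafDir b L) ⟩
  tail (map dirBefore (lsizes b))
    ≡⟨ map-tail dirBefore (lsizes b) ⟩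
  map dirBefore (tail (lsizes b))
    ∎
  where open ≡-Reasoning

length-node : (a c : BT) (x : ℕ) (xs ys : List ℕ) → length xs ≡ size a → length ys ≡ size c →
              length (xs ++ x ∷ ys) ≡ size (node a c)
length-node a c x xs ys lenA lenC = begin
  length (xs ++ x ∷ ys)        ≡⟨ length-++ xs ⟩
  length xs + suc (length ys)  ≡⟨ cong₂ (λ p q → p + suc q) lenA lenC ⟩
  size a + (1 + size c)        ≡⟨ +-assoc (size a) 1 (size c) ⟨
  size (node a c)              ∎
  where open ≡-Reasoning

length-rsizes : (b : BT) → length (rsizes b) ≡ size b
length-rsizes leaf       = refl
length-rsizes (node a c) = length-node a c (size c) (rsizes a) (rsizes c) (length-rsizes a) (length-rsizes c)

length-lsizes : (b : BT) → length (lsizes b) ≡ size b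
length-lsizes leaf       = refl
length-lsizes (node a c) = length-node a c (size a) (lsizes a) (lsizes c) (length-lsizes a) (length-lsizes c)

-- Leaf directions only move from R to L under rotations:  d ⊑ d'  means d'
-- equals d or d is R and d' is L.

data _⊑_ : Dir → Dir → Set where
  ⊑-refl : {d : Dir} → d ⊑ d
  R⊑L    : R ⊑ L

⊑-trans : {d₁ d₂ d₃ : Dir} → d₁ ⊑ d₂ → d₂ ⊑ d₃ → d₁ ⊑ d₃
⊑-trans ⊑-refl q      = q
⊑-trans R⊑L    ⊑-refl = R⊑L

_⊑*_ : List Dir → List Dir → Set
_⊑*_ = Pointwise _⊑_

⊑*-refl : {ds : List Dir} → ds ⊑* ds
⊑*-refl = Pw.refl ⊑-refl

-- Moving a subtree from a right to a left position only affects its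
-- first leaf, and only if the subtree is a single leaf.
leafDirs-R⊑L : (b : BT) → leafDirs b R ⊑* leafDirs b L
leafDirs-R⊑L leaf       = R⊑L ∷ []
leafDirs-R⊑L (node _ _) = ⊑*-refl

rotation-⊑* : {a a' : BT} → a ⟶r a' → (d : Dir) → leafDirs a d ⊑* leafDirs a' d
rotation-⊑* (rot a b c) d rewrite ++-assoc (leafDirs a L) (leafDirs b R) (leafDirs c R) =
  Pw.++⁺ (⊑*-refl {leafDirs a L}) (Pw.++⁺ (leafDirs-R⊑L b) (⊑*-refl {leafDirs c R}))
rotation-⊑* (left b s)  d = Pw.++⁺ (rotation-⊑* s L) ⊑*-refl
rotation-⊑* (right a s) d = Pw.++⁺ ⊑*-refl (rotation-⊑* s R)

canopy-⊑* : {a a' : BT} → a ≤t a' → canopy a ⊑* canopy a'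
canopy-⊑* st = pointwise-dropLast (pointwise-tail (leafDirs-⊑* st))
  where
  leafDirs-⊑* : {a a' : BT} → a ≤t a' → leafDirs a L ⊑* leafDirs a' L
  leafDirs-⊑* ε        = ⊑*-refl
  leafDirs-⊑* (s ◅ st) = Pw.transitive ⊑-trans (rotation-⊑* s L) (leafDirs-⊑* st)

Synchronized : ℕ → ℕ → Set
Synchronized x y = x ≢ 0 ⊎ y ≢ 0

-- When the direction after x can only move towards the direction before y,
-- they agree exactly at synchronized positions: the lone disagreement is
-- R above L, i.e. x = 0 and y = 0.
dirs-agree⇔synchronized : (x y : ℕ) → dirAfter x ⊑ dirBefore y →
                          (dirAfter x ≡ dirBefore y) ⇔ Synchronized x y
dirs-agree⇔synchronized zero    zero    _ = mk⇔ (λ ()) λ { (inj₁ x≢0) → ⊥-elim (x≢0 refl)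
                                                     ; (inj₂ y≢0) → ⊥-elim (y≢0 refl) }
dirs-agree⇔synchronized zero    (suc y) _ = mk⇔ (λ _ → inj₂ (λ ())) (λ _ → refl)
dirs-agree⇔synchronized (suc x) zero    _ = mk⇔ (λ _ → inj₁ (λ ())) (λ _ → refl)
dirs-agree⇔synchronized (suc x) (suc y) ()

map-dirs-agree⇔synchronized : {xs ys : List ℕ} → Pointwise (λ x y → dirAfter x ⊑ dirBefore y) xs ys →
                              (map dirAfter xs ≡ map dirBefore ys) ⇔ Pointwise Synchronized xs ys
map-dirs-agree⇔synchronized []                      = mk⇔ (λ _ → []) (λ _ → refl)
map-dirs-agree⇔synchronized {x ∷ xs} {y ∷ ys} (p ∷ ps) = mk⇔
  (λ eq → Equivalence.to (dirs-agree⇔synchronized x y p) (∷-injectiveˡ eq)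
        ∷ Equivalence.to (map-dirs-agree⇔synchronized ps) (∷-injectiveʳ eq))
  (λ { (s ∷ ss) → cong₂ _∷_ (Equivalence.from (dirs-agree⇔synchronized x y p) s)
                            (Equivalence.from (map-dirs-agree⇔synchronized ps) ss) })

labels⇔positions : (m : ℕ) (Q : ℕ → Set) →
                   ((i : ℕ) → 1 ≤ i → i + 1 ≤ suc m → Q i) ⇔ ((k : ℕ) → k < m → Q (suc k))
labels⇔positions m Q = mk⇔ to from
  where
  to : ((i : ℕ) → 1 ≤ i → i + 1 ≤ suc m → Q i) → (k : ℕ) → k < m → Q (suc k)
  to h k k<m = h (suc k) (s≤s z≤n) (s≤s (subst (_≤ m) (+-comm 1 k) k<m))

  from : ((k : ℕ) → k < m → Q (suc k)) → (i : ℕ) → 1 ≤ i → i + 1 ≤ suc m → Q i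
  from h (suc k) _ (s≤s k+1≤m) = h k (subst (_≤ m) (+-comm k 1) k+1≤m)

mainTheorem5 : (n : ℕ) → 1 ≤ n → (S T : BT) → size S ≡ n → size T ≡ n → S ≤t T →
    ((i : ℕ) → 1 ≤ i → i + 1 ≤ n → r S i ≢ 0 ⊎ l T (i + 1) ≢ 0) ⇔ (canopy S ≡ canopy T)
mainTheorem5 (suc m) (s≤s z≤n) S T sizeS sizeT S≤T = begin
  ((i : ℕ) → 1 ≤ i → i + 1 ≤ suc m → r S i ≢ 0 ⊎ l T (i + 1) ≢ 0)
    ≈⟨ labels⇔positions m _ ⟩
  ((k : ℕ) → k < m → Synchronized (at rs k) (at ls (k + 1)))
    ≈⟨ pointwise-shifted rs ls m (trans (length-rsizes S) sizeS) (trans (length-lsizes T) sizeT) ⟨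
  Pointwise Synchronized (dropLast rs) (tail ls)
    ≈⟨ map-dirs-agree⇔synchronized (Pw.map⁻ dirAfter dirBefore canopies-⊑*) ⟨
  (map dirAfter (dropLast rs) ≡ map dirBefore (tail ls))
    ≈⟨ subst₂ (λ cS cT → (cS ≡ cT) ⇔ (canopy S ≡ canopy T)) (canopy-rsizes S) (canopy-lsizes T) ⇔-refl ⟩
  (canopy S ≡ canopy T)
    ∎
  where
  open SetoidReasoning (⇔-setoid 0ℓ)
  rs ls : List ℕ
  rs = rsizes S
  ls = lsizes T

  canopies-⊑* : map dirAfter (dropLast rs) ⊑* map dirBefore (tail ls)
  canopies-⊑* = subst₂ _⊑*_ (canopy-rsizes S) (canopy-lsizes T) (canopy-⊑* S≤T)
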